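{- Let $(X,\mathcal R)$ be an imprimitive symmetric association scheme with a fixed imprimitivity system (a partition $\mathcal F$ of $X$ into fibres). Then $(X,\mathcal R)$ is dismantlable if and only if it is uniform.
   Context: A (symmetric) $d$-class association scheme $(X,\mathcal R)$ consists of a finite set $X$ and a partition $\mathcal R=\{R_0,\dots,R_d\}$ of $X\times X$ with $R_0=\{(x,x):x\in X\}$, each $R_i$ symmetric, and integers $p^h_{ij}$ such that for $(x,y)\in R_h$ the number of $z$ with $(x,z)\in R_i,(z,y)\in R_j$ equals $p^h_{ij}$. $A_i$ denotes the adjacency matrix of $R_i$. The scheme is imprimitive if some nontrivial relation is disconnected as a graph; then there is a set $\mathcal I$ with $\{0\}\subsetneq\mathcal I\subsetneq\{0,\dots,d\}$ such that $\bigcup_{i\in\mathcal I}R_i$ is an equivalence relation whose classes (the fibres, forming the imprimitivity system $\mathcal F$) all have the same size $n$; let $w$ be the number of fibres. For fibres $U,V$ let $\mathcal I(U,V)$ be the set of $i$ with $R_i\cap(U\times V)\neq\emptyset$, and for a matrix $M$ indexed by $X$ let $M^{UV}$ be the matrix agreeing with $M$ on $U\times V$ and zero elsewhere. The scheme is uniform if its quotient is trivial, i.e. $\mathcal I(U,V)=\{0,\dots,d\}\setminus\mathcal I$ for all distinct fibres $U,V$, and there are integers $a^h_{ij}$ such that for all fibres $U,V,W$ (not necessarily distinct) and all $i\in\mathcal I(U,V)$, $j\in\mathcal I(V,W)$ we have $A_i^{UV}A_j^{VW}=\sum_h a^h_{ij}A_h^{UW}$. The scheme is dismantlable if for every union $Y$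 of fibres, the nonempty relations among $R_i\cap(Y\times Y)$, $i=0,\dots,d$, form an association scheme on $Y$ (called a dismantled scheme when $Y$ is a union of at least two fibres). -}

module Defs where

open import Data.Nat using (ℕ; _*_; _+_)
open import Data.Fin using (Fin; zero; _≟_)
open import Data.Bool using (Bool; true; false; if_then_else_; _∧_)
open import Data.List using (tabulate)
open import Data.Nat.ListAction using (sum)
open import Data.Product using (_×_; ∃; ∃-syntax; Σ)
open import Relation.Nullary using (¬_)
open import Relation.Nullary.Decidable using (⌊_⌋)
open import Relation.Binary.PropositionalEquality using (_≡_; _≢_)
open import Function.Bundles using (_⇔_)

-- A candidate scheme on X = Fin N with d+1 relation indices is given by
-- r : Fin N → Fin N → Fin (suc d), where (x , y) ∈ R_i  iff  r x y ≡ i.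
-- (This encodes that R_0,…,R_d partition X × X.)

Rel : ℕ → ℕ → Set
Rel N d = Fin N → Fin N → Fin (Data.Nat.suc d)

Σ[_]_ : (n : ℕ) → (Fin n → ℕ) → ℕ
Σ[ n ] f = sum (tabulate f)

_∈ₛ_ : ∀ {N} → Fin N → (Fin N → Bool) → Set
x ∈ₛ Y = Y x ≡ true

count : ∀ {N d} → Rel N d → (Fin N → Bool) → Fin N → Fin N → Fin _ → Fin _ → ℕ
count {N} {d} r Y x y i j =
  Σ[ N ] (λ z → if Y z ∧ ⌊ r x z ≟ i ⌋ ∧ ⌊ r z y ≟ j ⌋ then 1 else 0)

Occurs : ∀ {N d} → Rel N d → (Fin N → Bool) → Fin (Data.Nat.suc d) → Set
Occurs r Y i = ∃[ x ] ∃[ y ] (x ∈ₛ Y × y ∈ₛ Y × r x y ≡ i)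

-- The nonempty relations among R_i ∩ (Y × Y) form a (symmetric) association
-- scheme on Y (with R_0 ∩ (Y×Y) as its diagonal relation).
IsSchemeOn : ∀ {N d} → (Fin N → Bool) → Rel N d → Set
IsSchemeOn {N} {d} Y r =
    (∀ x y → x ∈ₛ Y → y ∈ₛ Y → (r x y ≡ zero ⇔ x ≡ y))
  × (∀ x y → x ∈ₛ Y → y ∈ₛ Y → r x y ≡ r y x)
  × Σ (Fin (Data.Nat.suc d) → Fin (Data.Nat.suc d) → Fin (Data.Nat.suc d) → ℕ) (λ p →
      ∀ x y i j → x ∈ₛ Y → y ∈ₛ Y → Occurs r Y i → Occurs r Y j →
        count r Y x y i j ≡ p (r x y) i j)

IsAssocScheme : ∀ {N d} → Rel N d → Set
IsAssocScheme {N} r = (∀ i → Occurs r (λ _ → true) i) × IsSchemeOn (λ _ → true) r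

SameFibre : ∀ {N d} → Rel N d → (Fin (Data.Nat.suc d) → Bool) → Fin N → Fin N → Set
SameFibre r I x y = I (r x y) ≡ true

-- I determines an imprimitivity system:  {0} ⊊ I ⊊ {0,…,d}  and the union of
-- the R_i (i ∈ I) is an equivalence relation (reflexive and symmetric
-- automatically since 0 ∈ I and the scheme is symmetric).
IsImprimitivitySystem : ∀ {N d} → Rel N d → (Fin (Data.Nat.suc d) → Bool) → Set
IsImprimitivitySystem r I =
    I zero ≡ true
  × (∃[ i ] (i ≢ zero × I i ≡ true))
  × (∃[ i ] (I i ≡ false))
  × (∀ x y z → SameFibre r I x y → SameFibre r I y z → SameFibre r I x z)

-- Fibres are represented by any of their elements: the fibre of u.
fibre : ∀ {N d} → Rel N d → (Fin (Data.Nat.suc d) → Bool) → Fin N → Fin N → Bool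
fibre r I u x = I (r u x)

InI : ∀ {N d} → Rel N d → (Fin (Data.Nat.suc d) → Bool) → Fin N → Fin N → Fin (Data.Nat.suc d) → Set
InI r I u v i = ∃[ x ] ∃[ y ] (x ∈ₛ fibre r I u × y ∈ₛ fibre r I v × r x y ≡ i)

Mat : ℕ → Set
Mat N = Fin N → Fin N → ℕ

_≈ₘ_ : ∀ {N} → Mat N → Mat N → Set
M ≈ₘ M' = ∀ x y → M x y ≡ M' x y

_⊗_ : ∀ {N} → Mat N → Mat N → Mat N
_⊗_ {N} M M' x y = Σ[ N ] (λ z → M x z * M' z y)

adj : ∀ {N d} → Rel N d → Fin (Data.Nat.suc d) → Mat N
adj r i x y = if ⌊ r x y ≟ i ⌋ then 1 else 0

restrict : ∀ {N} → (Fin N → Bool) → (Fin N → Bool) → Mat N → Mat N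
restrict U V M x y = if U x ∧ V y then M x y else 0

Uniform : ∀ {N d} → Rel N d → (Fin (Data.Nat.suc d) → Bool) → Set
Uniform {N} {d} r I =
    (∀ u v → ¬ SameFibre r I u v → ∀ i → (InI r I u v i ⇔ I i ≡ false))
  × Σ (Fin (Data.Nat.suc d) → Fin (Data.Nat.suc d) → Fin (Data.Nat.suc d) → ℕ) (λ a →
      ∀ u v w i j → InI r I u v i → InI r I v w j →
        (restrict (fibre r I u) (fibre r I v) (adj r i)
          ⊗ restrict (fibre r I v) (fibre r I w) (adj r j))
        ≈ₘ (λ x y → Σ[ Data.Nat.suc d ] (λ h →
               a h i j * restrict (fibre r I u) (fibre r I w) (adj r h) x y)))

UnionOfFibres : ∀ {N d} → Rel N d → (Fin (Data.Nat.suc d) → Bool) → (Fin N → Bool) → Set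
UnionOfFibres r I Y = ∀ x y → x ∈ₛ Y → SameFibre r I x y → y ∈ₛ Y

Dismantlable : ∀ {N d} → Rel N d → (Fin (Data.Nat.suc d) → Bool) → Set
Dismantlable {N} r I =
  ∀ (Y : Fin N → Bool) → (∃[ y ] y ∈ₛ Y) → UnionOfFibres r I Y → IsSchemeOn Y r

module Submission where

-- A subset Y carries a subscheme
-- exactly when these counts, for x, y ∈ Y, depend only on the relation
-- between x and y (countInvariant, schemeOfInvariance).
--
-- (⇒) Counts over a union of fibres Y and over its complement add up to the
--   global intersection numbers, so counts through Y depend only on the
--   relation of endpoints outside Y (count-outside).  Comparing i-valencies
--   in the subschemes on two and three fibres shows that the quotient is
--   trivial (between-fibres).  Moving endpoints with count-outside and
--   comparing inside unions of two or three fibres, the number of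
--   (i,j)-paths through a fibre V with endpoints outside V depends only on
--   the relation of the endpoints (via-invariant): these numbers are the
--   uniformity coefficients.
-- (⇐) In a union of fibres Y, paths with a step inside a fibre are counted
--   globally.  For the others, summing the uniformity equation over the
--   fibres of Y gives  count · (fibre size) = a · |Y ∖ (fib x ∪ fib y)|
--   (double-count), and both a and that cardinality depend only on the
--   relation of (x,y).

open import Defs
open import Data.Nat using (ℕ; zero; suc; _+_; _*_; _≤_; _<_; z≤n; s≤s; >-nonZero)
open import Data.Nat.Properties
  using (+-identityʳ; *-identityʳ; *-zeroʳ; +-mono-≤; +-mono-<-≤; +-mono-≤-<; m≤m+n; m≤n+m;
         ≤-trans; <-irrefl; +-cancelˡ-≡; +-cancelʳ-≡; *-cancelʳ-≡; +-*-semiring)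
open import Data.Fin using (Fin; _≟_) renaming (zero to fzero; suc to fsuc)
open import Data.Fin.Properties using (any?)
open import Data.Bool using (Bool; true; false; if_then_else_; _∧_; _∨_; not)
import Data.Bool as Bool
open import Data.Bool.Properties
  using (∨-identityʳ; ∨-comm; ∨-idem; ∧-idem; ∧-zeroʳ; ∧-identityʳ; ¬-not)
open import Data.List.Properties using (tabulate-cong)
open import Data.Nat.ListAction using (sum)
open import Data.Product using (_×_; _,_; ∃; proj₁; proj₂)
open import Data.Sum using (_⊎_; inj₁; inj₂)
open import Data.Empty using (⊥; ⊥-elim)
open import Relation.Nullary using (¬_; Dec; yes; no)
open import Relation.Nullary.Decidable using (⌊_⌋; ⌊⌋-map′; _×-dec_)
open import Relation.Binary.PropositionalEquality
open ≡-Reasoning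
open import Function.Bundles using (_⇔_; mk⇔; Equivalence)
open import Algebra.Properties.Semiring.Sum +-*-semiring
  using (∑-distrib-+; ∑-comm; *-distribˡ-sum; *-distribʳ-sum; sum-replicate-zero)
  renaming (sum to ∑)

ind : Bool → ℕ
ind b = if b then 1 else 0

infixr 6 _∪_
_∪_ : {A : Set} → (A → Bool) → (A → Bool) → A → Bool
(P ∪ Q) z = P z ∨ Q z

Σ≡∑ : ∀ n (f : Fin n → ℕ) → Σ[ n ] f ≡ ∑ f
Σ≡∑ zero    f = refl
Σ≡∑ (suc n) f = cong (f fzero +_) (Σ≡∑ n (λ k → f (fsuc k)))

Σ-cong : ∀ n {f g : Fin n → ℕ} → (∀ k → f k ≡ g k) → Σ[ n ] f ≡ Σ[ n ] g
Σ-cong n f≗g = cong sum (tabulate-cong f≗g)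

Σ-zero : ∀ n → Σ[ n ] (λ _ → 0) ≡ 0
Σ-zero n = trans (Σ≡∑ n _) (sum-replicate-zero n)

Σ-+ : ∀ n (f g : Fin n → ℕ) → Σ[ n ] (λ k → f k + g k) ≡ Σ[ n ] f + Σ[ n ] g
Σ-+ n f g = trans (Σ≡∑ n _) (trans (∑-distrib-+ f g) (sym (cong₂ _+_ (Σ≡∑ n f) (Σ≡∑ n g))))

Σ-*ˡ : ∀ n c (f : Fin n → ℕ) → Σ[ n ] (λ k → c * f k) ≡ c * Σ[ n ] f
Σ-*ˡ n c f = trans (Σ≡∑ n _) (trans (sym (*-distribˡ-sum c f)) (cong (c *_) (sym (Σ≡∑ n f))))

Σ-*ʳ : ∀ n c (f : Fin n → ℕ) → Σ[ n ] (λ k → f k * c) ≡ Σ[ n ] f * c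
Σ-*ʳ n c f = trans (Σ≡∑ n _) (trans (sym (*-distribʳ-sum c f)) (cong (_* c) (sym (Σ≡∑ n f))))

Σ-comm : ∀ m n (f : Fin m → Fin n → ℕ) →
         Σ[ m ] (λ a → Σ[ n ] (f a)) ≡ Σ[ n ] (λ b → Σ[ m ] (λ a → f a b))
Σ-comm m n f = trans (Σ≡∑² m n f) (trans (∑-comm f) (sym (Σ≡∑² n m (λ b a → f a b))))
  where
  Σ≡∑² : ∀ m n (g : Fin m → Fin n → ℕ) → Σ[ m ] (λ a → Σ[ n ] (g a)) ≡ ∑ (λ a → ∑ (g a))
  Σ≡∑² m n g = trans (Σ-cong m (λ a → Σ≡∑ n (g a))) (Σ≡∑ m _)

Σ-select : ∀ n (f : Fin n → ℕ) g → Σ[ n ] (λ h → f h * ind ⌊ g ≟ h ⌋) ≡ f g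
Σ-select (suc n) f fzero =
  trans (cong₂ _+_ (*-identityʳ (f fzero)) (trans (Σ-cong n (λ h → *-zeroʳ (f (fsuc h)))) (Σ-zero n)))
        (+-identityʳ (f fzero))
Σ-select (suc n) f (fsuc g) =
  trans (cong₂ _+_ (*-zeroʳ (f fzero))
                   (Σ-cong n (λ h → cong (λ b → f (fsuc h) * ind b) (⌊⌋-map′ _ _ (g ≟ h)))))
        (Σ-select n (λ h → f (fsuc h)) g)

Σ-if : ∀ n b (g : Fin n → ℕ) → Σ[ n ] (λ k → if b then g k else 0) ≡ (if b then Σ[ n ] g else 0)
Σ-if n true  g = refl
Σ-if n false g = Σ-zero n

Σ-mono : ∀ n {f g : Fin n → ℕ} → (∀ k → f k ≤ g k) → Σ[ n ] f ≤ Σ[ n ] g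
Σ-mono zero    f≤g = z≤n
Σ-mono (suc n) f≤g = +-mono-≤ (f≤g fzero) (Σ-mono n (λ k → f≤g (fsuc k)))

Σ-mono-strict : ∀ n {f g : Fin n → ℕ} → (∀ k → f k ≤ g k) → ∀ k₀ → f k₀ < g k₀ →
                Σ[ n ] f < Σ[ n ] g
Σ-mono-strict (suc n) f≤g fzero     lt = +-mono-<-≤ lt (Σ-mono n (λ k → f≤g (fsuc k)))
Σ-mono-strict (suc n) f≤g (fsuc k₀) lt =
  +-mono-≤-< (f≤g fzero) (Σ-mono-strict n (λ k → f≤g (fsuc k)) k₀ lt)

term≤Σ : ∀ n (f : Fin n → ℕ) k → f k ≤ Σ[ n ] f
term≤Σ (suc n) f fzero    = m≤m+n (f fzero) _
term≤Σ (suc n) f (fsuc k) = ≤-trans (term≤Σ n (λ k → f (fsuc k)) k) (m≤n+m _ (f fzero))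

Σ-positive : ∀ n (f : Fin n → ℕ) → 0 < Σ[ n ] f → ∃ λ k → 0 < f k
Σ-positive (suc n) f pos with f fzero in eq
... | suc _ = fzero , subst (0 <_) (sym eq) (s≤s z≤n)
... | zero with Σ-positive n (λ k → f (fsuc k)) pos
...   | k , fk>0 = fsuc k , fk>0

true≢false : ∀ {b} → b ≡ true → b ≡ false → ⊥
true≢false refl ()

not-true : ∀ {b} → not b ≡ true → b ≡ false
not-true {false} _ = refl

not-false : ∀ {b} → b ≡ false → not b ≡ true
not-false refl = refl

from-does : ∀ {P : Set} (q : Dec P) → ⌊ q ⌋ ≡ true → P
from-does (yes p) _ = p

to-does : ∀ {P : Set} (q : Dec P) → P → ⌊ q ⌋ ≡ true
to-does (yes _)  _ = refl
to-does (no ¬p) p = ⊥-elim (¬p p)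

bool-ext : ∀ {a b} → (a ≡ true → b ≡ true) → (b ≡ true → a ≡ true) → a ≡ b
bool-ext {true}  {true}  _ _ = refl
bool-ext {true}  {false} f _ = sym (f refl)
bool-ext {false} {true}  _ g = g refl
bool-ext {false} {false} _ _ = refl

∧-elim : ∀ {a b} → a ∧ b ≡ true → a ≡ true × b ≡ true
∧-elim {true} h = refl , h

∧-elim₃ : ∀ {a b c} → a ∧ b ∧ c ≡ true → a ≡ true × b ≡ true × c ≡ true
∧-elim₃ {true} {true} h = refl , refl , h

∧-implied : ∀ {a b} → (a ≡ true → b ≡ true) → a ∧ b ≡ a
∧-implied {true}  a⇒b = a⇒b refl
∧-implied {false} _   = refl

not-∨ : ∀ {a b} → not (a ∨ b) ≡ true → a ≡ false × b ≡ false
not-∨ {false} {false} _ = refl , refl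

∨-introˡ : ∀ {a b} → a ≡ true → a ∨ b ≡ true
∨-introˡ refl = refl

∨-introʳ : ∀ {a b} → b ≡ true → a ∨ b ≡ true
∨-introʳ {true}  _ = refl
∨-introʳ {false} h = h

∨-elim : ∀ {a b} → a ∨ b ≡ true → a ≡ true ⊎ b ≡ true
∨-elim {true}  _ = inj₁ refl
∨-elim {false} h = inj₂ h

∨-middle : ∀ {a b c} → (a ∨ b) ∨ c ≡ true → a ≡ false → c ≡ false → b ≡ true
∨-middle {b = b} h refl refl = trans (sym (∨-identityʳ b)) h

∨-repeat : ∀ p q → p ∨ (q ∨ p) ≡ q ∨ (p ∨ q)
∨-repeat true  true  = refl
∨-repeat true  false = refl
∨-repeat false true  = refl
∨-repeat false false = refl

ind-positive : ∀ {b} → 0 < ind b → b ≡ true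
ind-positive {true} _ = refl

ind-true : ∀ {b} → b ≡ true → 0 < ind b
ind-true refl = s≤s z≤n

ind-mono : ∀ {a b} → (a ≡ true → b ≡ true) → ind a ≤ ind b
ind-mono {false} _   = z≤n
ind-mono {true}  a⇒b = ind-true (a⇒b refl)

ind-split : ∀ a p → ind p ≡ ind (not a ∧ p) + ind (a ∧ p)
ind-split true  p     = refl
ind-split false true  = refl
ind-split false false = refl

ind-∨ : ∀ {a b} → (a ≡ true → b ≡ true → ⊥) → ind (a ∨ b) ≡ ind a + ind b
ind-∨ {true}  {true}  disj = ⊥-elim (disj refl refl)
ind-∨ {true}  {false} _    = refl
ind-∨ {false}         _    = refl

ind-scale : ∀ b {m n} → (b ≡ true → m ≡ n) → m * ind b ≡ ind b * n
ind-scale true  eq = trans (*-identityʳ _) (trans (eq refl) (sym (+-identityʳ _)))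
ind-scale false {m} _ = *-zeroʳ m

ind-exchange : ∀ p f y q → (f ≡ true → q ≡ true → p ≡ y) →
               ind p * ind (f ∧ q) ≡ ind (y ∧ q) * ind f
ind-exchange p false y q     _  = trans (*-zeroʳ (ind p)) (sym (*-zeroʳ (ind (y ∧ q))))
ind-exchange p true  y false _  = trans (*-zeroʳ (ind p)) (cong (λ b → ind b * 1) (sym (∧-zeroʳ y)))
ind-exchange p true  y true  eq = cong (λ b → ind b * 1) (trans (eq refl refl) (sym (∧-identityʳ y)))

if-true : ∀ {b} {m : ℕ} → b ≡ true → (if b then m else 0) ≡ m
if-true refl = refl

if-congᵗ : ∀ b {m n : ℕ} → (b ≡ true → m ≡ n) → (if b then m else 0) ≡ (if b then n else 0)
if-congᵗ true  eq = eq refl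
if-congᵗ false _  = refl

restrict-product : ∀ u v w c e →
  (if u ∧ v then ind c else 0) * (if v ∧ w then ind e else 0) ≡ (if u ∧ w then ind (v ∧ c ∧ e) else 0)
restrict-product false v     w     c     e     = refl
restrict-product true  false false c     e     = refl
restrict-product true  false true  c     e     = refl
restrict-product true  true  false c     e     = *-zeroʳ (ind c)
restrict-product true  true  true  false e     = refl
restrict-product true  true  true  true  false = refl
restrict-product true  true  true  true  true  = refl

-- Paths of length two in an arbitrary coloured complete graph r.

module Paths {N d : ℕ} (r : Rel N d) where

  onPath : (Fin N → Bool) → Fin N → Fin N → Fin (suc d) → Fin (suc d) → Fin N → Bool
  onPath Y x y i j z = Y z ∧ ⌊ r x z ≟ i ⌋ ∧ ⌊ r z y ≟ j ⌋

  onPath-elim : ∀ Y x y i j z → onPath Y x y i j z ≡ true → Y z ≡ true × r x z ≡ i × r z y ≡ j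
  onPath-elim Y x y i j z h with ∧-elim₃ {Y z} h
  ... | Yz , xz , zy = Yz , from-does (r x z ≟ i) xz , from-does (r z y ≟ j) zy

  onPath-intro : ∀ Y x y i j z → Y z ≡ true → r x z ≡ i → r z y ≡ j → onPath Y x y i j z ≡ true
  onPath-intro Y x y i j z Yz xz zy =
    cong₂ _∧_ Yz (cong₂ _∧_ (to-does (r x z ≟ i) xz) (to-does (r z y ≟ j) zy))

  onPath-mono : ∀ Y Y' x y i j z → (r x z ≡ i → r z y ≡ j → Y z ≡ true → Y' z ≡ true) →
                onPath Y x y i j z ≡ true → onPath Y' x y i j z ≡ true
  onPath-mono Y Y' x y i j z Y⊆Y' h with onPath-elim Y x y i j z h
  ... | Yz , xz , zy = onPath-intro Y' x y i j z (Y⊆Y' xz zy Yz) xz zy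

  count-cong : ∀ Y Y' x y i j → (∀ z → r x z ≡ i → r z y ≡ j → Y z ≡ Y' z) →
               count r Y x y i j ≡ count r Y' x y i j
  count-cong Y Y' x y i j same = Σ-cong N (λ z → cong ind (bool-ext
    (onPath-mono Y Y' x y i j z (λ xz zy Yz → trans (sym (same z xz zy)) Yz))
    (onPath-mono Y' Y x y i j z (λ xz zy Y'z → trans (same z xz zy) Y'z))))

  count-positive : ∀ Y x y i j z → Y z ≡ true → r x z ≡ i → r z y ≡ j → 0 < count r Y x y i j
  count-positive Y x y i j z Yz xz zy =
    ≤-trans (ind-true (onPath-intro Y x y i j z Yz xz zy)) (term≤Σ N _ z)

  count-witness : ∀ Y x y i j → 0 < count r Y x y i j → ∃ λ z → Y z ≡ true × r x z ≡ i × r z y ≡ j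
  count-witness Y x y i j pos with Σ-positive N _ pos
  ... | z , term>0 = z , onPath-elim Y x y i j z (ind-positive term>0)

  count-absent : ∀ Y x y i j → (∀ z → Y z ≡ true → r x z ≡ i → r z y ≡ j → ⊥) →
                 count r Y x y i j ≡ 0
  count-absent Y x y i j no-path =
    trans (Σ-cong N (λ z → cong ind (¬-not (λ h → absent z (onPath-elim Y x y i j z h))))) (Σ-zero N)
    where
    absent : ∀ z → Y z ≡ true × r x z ≡ i × r z y ≡ j → ⊥
    absent z (Yz , xz , zy) = no-path z Yz xz zy

  count-strict : ∀ Y Y' x y i j → (∀ z → Y z ≡ true → Y' z ≡ true) →
                 ∀ z → Y z ≡ false → Y' z ≡ true → r x z ≡ i → r z y ≡ j →
                 count r Y x y i j < count r Y' x y i j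
  count-strict Y Y' x y i j Y⊆Y' z Yz Y'z xz zy =
    Σ-mono-strict N (λ w → ind-mono (onPath-mono Y Y' x y i j w (λ _ _ → Y⊆Y' w))) z
      (subst (λ b → ind (b ∧ ⌊ r x z ≟ i ⌋ ∧ ⌊ r z y ≟ j ⌋) < ind (onPath Y' x y i j z)) (sym Yz)
             (ind-true (onPath-intro Y' x y i j z Y'z xz zy)))

  count-complement : ∀ Y x y i j →
    count r (λ _ → true) x y i j ≡ count r (λ z → not (Y z)) x y i j + count r Y x y i j
  count-complement Y x y i j =
    trans (Σ-cong N (λ z → ind-split (Y z) (⌊ r x z ≟ i ⌋ ∧ ⌊ r z y ≟ j ⌋))) (Σ-+ N _ _)

  occursBetween? : ∀ (A B : Fin N → Bool) i →
                   Dec (∃ λ x → ∃ λ y → A x ≡ true × B y ≡ true × r x y ≡ i)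
  occursBetween? A B i =
    any? (λ x → any? (λ y → (A x Bool.≟ true) ×-dec (B y Bool.≟ true) ×-dec (r x y ≟ i)))

  CountInvariant : (Fin N → Bool) → Set
  CountInvariant Y = ∀ {x y x' y'} i j → Y x ≡ true → Y y ≡ true → Y x' ≡ true → Y y' ≡ true →
                     r x y ≡ r x' y' → count r Y x y i j ≡ count r Y x' y' i j

  -- A subscheme is count invariant, also for indices that do not occur in it.
  countInvariant : ∀ {Y} → IsSchemeOn Y r → CountInvariant Y
  countInvariant {Y} (_ , _ , p , p-correct) {x} {y} {x'} {y'} i j Yx Yy Yx' Yy' eq
    with occursBetween? Y Y i | occursBetween? Y Y j
  ... | yes oi | yes oj =
    trans (p-correct x y i j Yx Yy oi oj)
          (trans (cong (λ h → p h i j) eq) (sym (p-correct x' y' i j Yx' Yy' oi oj)))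
  ... | no ¬oi | _ =
    trans (count-absent Y x y i j (λ z Yz xz _ → ¬oi (x , z , Yx , Yz , xz)))
          (sym (count-absent Y x' y' i j (λ z Yz xz _ → ¬oi (x' , z , Yx' , Yz , xz))))
  ... | yes _ | no ¬oj =
    trans (count-absent Y x y i j (λ z Yz _ zy → ¬oj (z , y , Yz , Yy , zy)))
          (sym (count-absent Y x' y' i j (λ z Yz _ zy → ¬oj (z , y' , Yz , Yy' , zy))))

  valency-invariant : ∀ {Y x x'} → IsSchemeOn Y r → ∀ i j → Y x ≡ true → Y x' ≡ true →
                      count r Y x x i j ≡ count r Y x' x' i j
  valency-invariant {x = x} {x'} sch@(diagonal , _) i j Yx Yx' =
    countInvariant sch i j Yx Yx Yx' Yx'
      (trans (Equivalence.from (diagonal x x Yx Yx) refl) (sym (Equivalence.from (diagonal x' x' Yx' Yx') refl)))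

  productEntry : ∀ U V W i j x y →
    (restrict U V (adj r i) ⊗ restrict V W (adj r j)) x y ≡ (if U x ∧ W y then count r V x y i j else 0)
  productEntry U V W i j x y =
    trans (Σ-cong N (λ z → restrict-product (U x) (V z) (W y) ⌊ r x z ≟ i ⌋ ⌊ r z y ≟ j ⌋))
          (Σ-if N (U x ∧ W y) _)

  combinationEntry : ∀ U W (c : Fin (suc d) → ℕ) x y →
    Σ[ suc d ] (λ h → c h * restrict U W (adj r h) x y) ≡ (if U x ∧ W y then c (r x y) else 0)
  combinationEntry U W c x y with U x ∧ W y
  ... | true  = Σ-select (suc d) c (r x y)
  ... | false = trans (Σ-cong (suc d) (λ h → *-zeroʳ (c h))) (Σ-zero (suc d))

module Scheme {N d : ℕ} (r : Rel N d) (scheme : IsAssocScheme r) where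
  open Paths r

  everything : Fin N → Bool
  everything _ = true

  r-sym : ∀ x y → r x y ≡ r y x
  r-sym x y = proj₁ (proj₂ (proj₂ scheme)) x y refl refl

  r-diag : ∀ x → r x x ≡ fzero
  r-diag x = Equivalence.from (proj₁ (proj₂ scheme) x x refl refl) refl

  p : Fin (suc d) → Fin (suc d) → Fin (suc d) → ℕ
  p = proj₁ (proj₂ (proj₂ (proj₂ scheme)))

  count-total : ∀ x y i j → count r everything x y i j ≡ p (r x y) i j
  count-total x y i j =
    proj₂ (proj₂ (proj₂ (proj₂ scheme))) x y i j refl refl (proj₁ scheme i) (proj₁ scheme j)

  valency : ∀ x i → Σ[ N ] (λ z → ind ⌊ r x z ≟ i ⌋) ≡ p fzero i i
  valency x i = trans (Σ-cong N closedWalk) (trans (count-total x x i i) (cong (λ h → p h i i) (r-diag x)))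
    where
    closedWalk : ∀ z → ind ⌊ r x z ≟ i ⌋ ≡ ind (onPath everything x x i i z)
    closedWalk z = cong ind (sym (trans (cong (λ h → ⌊ r x z ≟ i ⌋ ∧ ⌊ h ≟ i ⌋) (r-sym z x))
                                        (∧-idem ⌊ r x z ≟ i ⌋)))

  valency-positive : ∀ i → 0 < p fzero i i
  valency-positive i with proj₁ scheme i
  ... | x₀ , y₀ , _ , _ , x₀y₀ =
    subst (0 <_) (valency x₀ i) (≤-trans (ind-true (to-does (r x₀ y₀ ≟ i) x₀y₀)) (term≤Σ N _ y₀))

  neighbour : ∀ i u → ∃ λ z → r u z ≡ i
  neighbour i u with Σ-positive N _ (subst (0 <_) (sym (valency u i)) (valency-positive i))
  ... | z , uz = z , from-does (r u z ≟ i) (ind-positive uz)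

  count-full : ∀ Y x y i j → (∀ z → r x z ≡ i → r z y ≡ j → Y z ≡ true) →
               count r Y x y i j ≡ p (r x y) i j
  count-full Y x y i j inY = trans (count-cong Y everything x y i j inY) (count-total x y i j)

  schemeOfInvariance : ∀ Y → CountInvariant Y → IsSchemeOn Y r
  schemeOfInvariance Y invariant =
    (λ x y _ _ → proj₁ (proj₂ scheme) x y refl refl) ,
    (λ x y _ _ → r-sym x y) ,
    (λ h i j → representative h i j (occursBetween? Y Y h)) ,
    correct
    where
    representative : ∀ h i j → Dec (Occurs r Y h) → ℕ
    representative h i j (yes (x₀ , y₀ , _)) = count r Y x₀ y₀ i j
    representative h i j (no _)              = 0
    correct : ∀ x y i j → Y x ≡ true → Y y ≡ true → Occurs r Y i → Occurs r Y j →
              count r Y x y i j ≡ representative (r x y) i j (occursBetween? Y Y (r x y))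
    correct x y i j Yx Yy _ _ with occursBetween? Y Y (r x y)
    ... | yes (x₀ , y₀ , Yx₀ , Yy₀ , x₀y₀) = invariant i j Yx Yy Yx₀ Yy₀ (sym x₀y₀)
    ... | no ¬occ                          = ⊥-elim (¬occ (x , y , Yx , Yy , refl))

-- The fibres of an imprimitivity system.

module Fibres {N d : ℕ} (r : Rel N d) (scheme : IsAssocScheme r)
              (I : Fin (suc d) → Bool) (imprimitive : IsImprimitivitySystem r I) where
  open Paths r
  open Scheme r scheme

  fib : Fin N → Fin N → Bool
  fib = fibre r I

  same-refl : ∀ x → SameFibre r I x x
  same-refl x = subst (λ h → I h ≡ true) (sym (r-diag x)) (proj₁ imprimitive)

  same-sym : ∀ {x y} → SameFibre r I x y → SameFibre r I y x
  same-sym {x} {y} = subst (λ h → I h ≡ true) (r-sym x y)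

  same-trans : ∀ {x y z} → SameFibre r I x y → SameFibre r I y z → SameFibre r I x z
  same-trans {x} {y} {z} = proj₂ (proj₂ (proj₂ imprimitive)) x y z

  fib-sym : ∀ x y → fib x y ≡ fib y x
  fib-sym x y = cong I (r-sym x y)

  I-respects : ∀ {x x' y y'} → SameFibre r I x x' → SameFibre r I y y' → I (r x y) ≡ I (r x' y')
  I-respects xx' yy' = bool-ext
    (λ xy → same-trans (same-trans (same-sym xx') xy) yy')
    (λ x'y' → same-trans (same-trans xx' x'y') (same-sym yy'))

  fib-congˡ : ∀ {u u'} z → SameFibre r I u u' → fib u z ≡ fib u' z
  fib-congˡ z uu' = I-respects uu' (same-refl z)

  fib-congʳ : ∀ u {z z'} → SameFibre r I z z' → fib u z ≡ fib u z'
  fib-congʳ u zz' = I-respects (same-refl u) zz'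

  leaves : ∀ {x z i} → I i ≡ false → r x z ≡ i → fib x z ≡ false
  leaves i∉I xz = trans (cong I xz) i∉I

  apart-points : ∀ {x y} w → I (r x y) ≡ false → fib w x ≡ false ⊎ fib w y ≡ false
  apart-points {x} {y} w xy with fib w x in wx | fib w y in wy
  ... | false | _     = inj₁ refl
  ... | true  | false = inj₂ refl
  ... | true  | true  = ⊥-elim (true≢false (same-trans (same-sym wx) wy) xy)

  InI-index : ∀ {u v i} → InI r I u v i → I i ≡ I (r u v)
  InI-index (x , y , ux , vy , xy) = trans (sym (cong I xy)) (I-respects (same-sym ux) (same-sym vy))

  InI-fibreˡ : ∀ {u v i x} → InI r I u v i → fib u x ≡ true → fib v x ≡ I i
  InI-fibreˡ {u} {v} occ ux =
    trans (I-respects (same-refl v) (same-sym ux)) (trans (fib-sym v u) (sym (InI-index occ)))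

  InI-fibreʳ : ∀ {u v i y} → InI r I u v i → fib v y ≡ true → fib u y ≡ I i
  InI-fibreʳ {u} {v} occ vy = trans (I-respects (same-refl u) (same-sym vy)) (sym (InI-index occ))

  fibre-isUnion : ∀ u → UnionOfFibres r I (fib u)
  fibre-isUnion u x y ux xy = same-trans ux xy

  ∪-isUnion : ∀ {Y Y'} → UnionOfFibres r I Y → UnionOfFibres r I Y' → UnionOfFibres r I (Y ∪ Y')
  ∪-isUnion {Y} uY uY' x y Yx xy with ∨-elim {Y x} Yx
  ... | inj₁ inY  = ∨-introˡ (uY x y inY xy)
  ... | inj₂ inY' = ∨-introʳ {Y y} (uY' x y inY' xy)

  complement-isUnion : ∀ {Y} → UnionOfFibres r I Y → UnionOfFibres r I (λ z → not (Y z))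
  complement-isUnion {Y} uY x y ¬Yx xy with Y y in Yy
  ... | false = refl
  ... | true  = ⊥-elim (true≢false (uY y x Yy (same-sym xy)) (not-true ¬Yx))

  -- Paths whose first (resp. last) step stays in a fibre stay inside any union
  -- of fibres containing the start (resp. end), so they are counted globally.
  count-in-fibreˡ : ∀ {Y} → UnionOfFibres r I Y → ∀ {x} y i j → Y x ≡ true → I i ≡ true →
                    count r Y x y i j ≡ p (r x y) i j
  count-in-fibreˡ {Y} uY {x} y i j Yx i∈I =
    count-full Y x y i j (λ z xz _ → uY x z Yx (trans (cong I xz) i∈I))

  count-in-fibreʳ : ∀ {Y} → UnionOfFibres r I Y → ∀ x {y} i j → Y y ≡ true → I j ≡ true →
                    count r Y x y i j ≡ p (r x y) i j
  count-in-fibreʳ {Y} uY x {y} i j Yy j∈I =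
    count-full Y x y i j (λ z _ zy → uY y z Yy (same-sym (trans (cong I zy) j∈I)))

  via : Fin N → Fin N → Fin N → Fin (suc d) → Fin (suc d) → ℕ
  via v = count r (fib v)

  -- All fibres have the same size n = Σ_{i ∈ I} p^0_ii, the sum of the valencies
  -- of the relations inside fibres.
  fibreCard : ℕ
  fibreCard = Σ[ suc d ] (λ i → ind (I i) * p fzero i i)

  fibreSize : ∀ x → Σ[ N ] (λ z → ind (fib x z)) ≡ fibreCard
  fibreSize x = begin
    Σ[ N ] (λ z → ind (fib x z))
      ≡⟨ Σ-cong N (λ z → sym (Σ-select (suc d) (λ i → ind (I i)) (r x z))) ⟩
    Σ[ N ] (λ z → Σ[ suc d ] (λ i → ind (I i) * ind ⌊ r x z ≟ i ⌋))
      ≡⟨ Σ-comm N (suc d) (λ z i → ind (I i) * ind ⌊ r x z ≟ i ⌋) ⟩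
    Σ[ suc d ] (λ i → Σ[ N ] (λ z → ind (I i) * ind ⌊ r x z ≟ i ⌋))
      ≡⟨ Σ-cong (suc d) (λ i → trans (Σ-*ˡ N (ind (I i)) _) (cong (ind (I i) *_) (valency x i))) ⟩
    fibreCard ∎

  fibreCard-positive : Fin N → 0 < fibreCard
  fibreCard-positive x =
    subst (0 <_) (fibreSize x) (≤-trans (ind-true (same-refl x)) (term≤Σ N _ x))

  pairSize : ∀ x y → Σ[ N ] (λ z → ind ((fib x ∪ fib y) z)) ≡
                     (if I (r x y) then fibreCard else fibreCard + fibreCard)
  pairSize x y with I (r x y) in xy
  ... | true  = trans (Σ-cong N (λ z → cong ind (trans (cong (fib x z ∨_) (fib-congˡ z (same-sym xy)))
                                                       (∨-idem (fib x z)))))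
                      (fibreSize x)
  ... | false = trans (Σ-cong N (λ z → ind-∨ (λ xz yz → true≢false (same-trans xz (same-sym yz)) xy)))
                      (trans (Σ-+ N _ _) (cong₂ _+_ (fibreSize x) (fibreSize y)))

  -- Dismantlable ⇒ uniform.

  module FromDismantlable (dismantlable : Dismantlable r I) where

    subscheme : ∀ Y {x} → UnionOfFibres r I Y → Y x ≡ true → IsSchemeOn Y r
    subscheme Y {x} uY Yx = dismantlable Y (x , Yx) uY

    -- Counts through a union of fibres Y depend only on the relation between
    -- endpoints outside Y: they complete the counts of the subscheme X ∖ Y.
    count-outside : ∀ {Y} → UnionOfFibres r I Y → ∀ {x y x' y'} i j →
                    Y x ≡ false → Y y ≡ false → Y x' ≡ false → Y y' ≡ false → r x y ≡ r x' y' →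
                    count r Y x y i j ≡ count r Y x' y' i j
    count-outside {Y} uY {x} {y} {x'} {y'} i j Yx Yy Yx' Yy' xy≡ =
      +-cancelˡ-≡ (count r Yᶜ x y i j) _ _ (begin
        count r Yᶜ x y i j + count r Y x y i j     ≡⟨ sym (count-complement Y x y i j) ⟩
        count r everything x y i j                 ≡⟨ count-total x y i j ⟩
        p (r x y) i j                              ≡⟨ cong (λ h → p h i j) xy≡ ⟩
        p (r x' y') i j                            ≡⟨ sym (count-total x' y' i j) ⟩
        count r everything x' y' i j               ≡⟨ count-complement Y x' y' i j ⟩
        count r Yᶜ x' y' i j + count r Y x' y' i j ≡⟨ cong (_+ count r Y x' y' i j) (sym complementary) ⟩
        count r Yᶜ x y i j + count r Y x' y' i j   ∎)
      where
      Yᶜ : Fin N → Bool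
      Yᶜ z = not (Y z)
      complementary : count r Yᶜ x y i j ≡ count r Yᶜ x' y' i j
      complementary = countInvariant (subscheme Yᶜ (complement-isUnion uY) (not-false Yx)) i j
                        (not-false Yx) (not-false Yy) (not-false Yx') (not-false Yy') xy≡

    -- If i ∉ I never joins the fibres U and V, compare i-valencies in the
    -- subschemes U ∪ Z and U ∪ Z ∪ V, with Z the fibre of an i-neighbour of u.
    no-gap : ∀ {u v i} → ¬ SameFibre r I u v → I i ≡ false → ¬ InI r I u v i → ⊥
    no-gap {u} {v} {i} u≁v i∉I gap =
      <-irrefl same-valency
        (count-strict Y₂ Y₃ y y i i (λ _ → ∨-introˡ) v Y₂v Y₃v (trans (r-sym y v) vy) vy)
      where
      z₀ : Fin N
      z₀ = proj₁ (neighbour i u)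
      uz₀ : r u z₀ ≡ i
      uz₀ = proj₂ (neighbour i u)
      Y₂ Y₃ : Fin N → Bool
      Y₂ = fib u ∪ fib z₀
      Y₃ = Y₂ ∪ fib v
      Y₂u : Y₂ u ≡ true
      Y₂u = ∨-introˡ (same-refl u)
      Y₃u : Y₃ u ≡ true
      Y₃u = ∨-introˡ Y₂u
      Y₃v : Y₃ v ≡ true
      Y₃v = ∨-introʳ {Y₂ v} (same-refl v)
      scheme₂ : IsSchemeOn Y₂ r
      scheme₂ = subscheme Y₂ (∪-isUnion (fibre-isUnion u) (fibre-isUnion z₀)) Y₂u
      scheme₃ : IsSchemeOn Y₃ r
      scheme₃ = subscheme Y₃
        (∪-isUnion (∪-isUnion (fibre-isUnion u) (fibre-isUnion z₀)) (fibre-isUnion v)) Y₃u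
      -- No i-neighbour of u lies in V, so adding V does not change its i-valency.
      u-valency : count r Y₃ u u i i ≡ count r Y₂ u u i i
      u-valency = count-cong Y₃ Y₂ u u i i (λ z uz _ →
        trans (cong (Y₂ z ∨_) (¬-not (λ vz → gap (u , z , same-refl u , vz , uz)))) (∨-identityʳ (Y₂ z)))
      -- Like u, the vertex v has an i-neighbour y in Y₃ …
      v-neighbour : ∃ λ y → Y₃ y ≡ true × r v y ≡ i × r y v ≡ i
      v-neighbour = count-witness Y₃ v v i i
        (subst (0 <_) (valency-invariant scheme₃ i i Y₃u Y₃v)
               (count-positive Y₃ u u i i z₀ (∨-introˡ {Y₂ z₀} (∨-introʳ {fib u z₀} (same-refl z₀)))
                               uz₀ (trans (r-sym z₀ u) uz₀)))
      y : Fin N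
      y = proj₁ v-neighbour
      vy : r v y ≡ i
      vy = proj₁ (proj₂ (proj₂ v-neighbour))
      -- … which lies in Z, since it is neither in U (no gap) nor in V (i ∉ I).
      z₀y : fib z₀ y ≡ true
      z₀y = ∨-middle (proj₁ (proj₂ v-neighbour))
              (¬-not (λ uy → gap (y , v , uy , same-refl v , trans (r-sym y v) vy))) (leaves i∉I vy)
      Y₂v : Y₂ v ≡ false
      Y₂v = cong₂ _∨_ (¬-not u≁v)
              (¬-not (λ z₀v → true≢false (same-trans (same-sym z₀y) z₀v)
                                         (trans (fib-sym y v) (leaves i∉I vy))))
      -- Yet y has the same i-valency in Y₂ and Y₃, although v ∉ Y₂ is an i-neighbour.
      same-valency : count r Y₂ y y i i ≡ count r Y₃ y y i i
      same-valency = begin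
        count r Y₂ y y i i ≡⟨ valency-invariant scheme₂ i i (∨-introʳ z₀y) Y₂u ⟩
        count r Y₂ u u i i ≡⟨ sym u-valency ⟩
        count r Y₃ u u i i ≡⟨ valency-invariant scheme₃ i i Y₃u
                                (∨-introˡ {Y₂ y} (∨-introʳ {fib u y} z₀y)) ⟩
        count r Y₃ y y i i ∎

    between-fibres : ∀ {u v i} → ¬ SameFibre r I u v → I i ≡ false → InI r I u v i
    between-fibres {u} {v} {i} u≁v i∉I with occursBetween? (fib u) (fib v) i
    ... | yes occ = occ
    ... | no gap  = ⊥-elim (no-gap u≁v i∉I gap)

    through-fibre : ∀ {i j} v a b → I i ≡ false → I j ≡ false →
                    count r (fib a ∪ fib v ∪ fib b) a b i j ≡ via v a b i j
    through-fibre {i} {j} v a b i∉I j∉I = count-cong (fib a ∪ fib v ∪ fib b) (fib v) a b i j (λ z az zb →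
      trans (cong₂ (λ s t → s ∨ (fib v z ∨ t)) (leaves i∉I az) (trans (fib-sym b z) (leaves j∉I zb)))
            (∨-identityʳ (fib v z)))

    -- Two configurations spanning the same union of fibres Y: the subscheme on Y
    -- trades paths through one fibre for paths through another.
    via-swap : ∀ {i j v v' a b a' b'} → I i ≡ false → I j ≡ false → r a b ≡ r a' b' →
               (∀ z → (fib a ∪ fib v ∪ fib b) z ≡ (fib a' ∪ fib v' ∪ fib b') z) →
               via v a b i j ≡ via v' a' b' i j
    via-swap {i} {j} {v} {v'} {a} {b} {a'} {b'} i∉I j∉I ab≡ sameUnion = begin
      via v a b i j        ≡⟨ sym (through-fibre v a b i∉I j∉I) ⟩
      count r Y a b i j    ≡⟨ countInvariant (subscheme Y Y-isUnion Ya) i j Ya Yb Ya' Yb' ab≡ ⟩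
      count r Y a' b' i j  ≡⟨ count-cong Y Y' a' b' i j (λ z _ _ → sameUnion z) ⟩
      count r Y' a' b' i j ≡⟨ through-fibre v' a' b' i∉I j∉I ⟩
      via v' a' b' i j     ∎
      where
      Y Y' : Fin N → Bool
      Y  = fib a ∪ fib v ∪ fib b
      Y' = fib a' ∪ fib v' ∪ fib b'
      Y-isUnion : UnionOfFibres r I Y
      Y-isUnion = ∪-isUnion (fibre-isUnion a) (∪-isUnion (fibre-isUnion v) (fibre-isUnion b))
      Ya : Y a ≡ true
      Ya = ∨-introˡ (same-refl a)
      Yb : Y b ≡ true
      Yb = ∨-introʳ {fib a b} (∨-introʳ {fib v b} (same-refl b))
      Ya' : Y a' ≡ true
      Ya' = trans (sameUnion a') (∨-introˡ (same-refl a'))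
      Yb' : Y b' ≡ true
      Yb' = trans (sameUnion b') (∨-introʳ {fib a' b'} (∨-introʳ {fib v' b'} (same-refl b')))

    -- Paths through V = V': count-outside moves the endpoints directly.
    via-sameFibre : ∀ {i j v v' x y x' y'} → SameFibre r I v v' →
                    fib v x ≡ false → fib v y ≡ false → fib v' x' ≡ false → fib v' y' ≡ false →
                    r x y ≡ r x' y' → via v x y i j ≡ via v' x' y' i j
    via-sameFibre {i} {j} {v} {v'} {x} {y} {x'} {y'} vv' vx vy v'x' v'y' xy≡ =
      trans (count-outside (fibre-isUnion v) i j vx vy
                           (trans (fib-congˡ x' vv') v'x') (trans (fib-congˡ y' vv') v'y') xy≡)
            (count-cong (fib v) (fib v') x' y' i j (λ z _ _ → fib-congˡ z vv'))

    -- V ≠ V', endpoints in a common fibre: replace (x,y) by a pair (v',b) inside V'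
    -- and (x',y') by a pair (v,b') inside V, and compare inside V ∪ V'.
    via-apart-inside : ∀ {i j v v' x y x' y'} → I i ≡ false → I j ≡ false →
                       fib v v' ≡ false → I (r x y) ≡ true →
                       fib v x ≡ false → fib v y ≡ false → fib v' x' ≡ false → fib v' y' ≡ false →
                       r x y ≡ r x' y' → via v x y i j ≡ via v' x' y' i j
    via-apart-inside {i} {j} {v} {v'} {x} {y} {x'} {y'} i∉I j∉I vv' xy∈I vx vy v'x' v'y' xy≡ = begin
      via v x y i j    ≡⟨ count-outside (fibre-isUnion v) i j vx vy vv' vb (sym v'b) ⟩
      via v v' b i j   ≡⟨ via-swap i∉I j∉I (trans v'b (sym vb')) sameUnion ⟩
      via v' v b' i j  ≡⟨ count-outside (fibre-isUnion v') i j (trans (fib-sym v' v) vv') v'b'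
                                        v'x' v'y' (trans vb' xy≡) ⟩
      via v' x' y' i j ∎
      where
      b b' : Fin N
      b  = proj₁ (neighbour (r x y) v')
      b' = proj₁ (neighbour (r x y) v)
      v'b : r v' b ≡ r x y
      v'b = proj₂ (neighbour (r x y) v')
      vb' : r v b' ≡ r x y
      vb' = proj₂ (neighbour (r x y) v)
      b∈V' : SameFibre r I v' b
      b∈V' = trans (cong I v'b) xy∈I
      b'∈V : SameFibre r I v b'
      b'∈V = trans (cong I vb') xy∈I
      vb : fib v b ≡ false
      vb = trans (fib-congʳ v (same-sym b∈V')) vv'
      v'b' : fib v' b' ≡ false
      v'b' = trans (fib-congʳ v' (same-sym b'∈V)) (trans (fib-sym v' v) vv')
      sameUnion : ∀ z → (fib v' ∪ fib v ∪ fib b) z ≡ (fib v ∪ fib v' ∪ fib b') z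
      sameUnion z =
        trans (cong (λ t → fib v' z ∨ (fib v z ∨ t)) (fib-congˡ z (same-sym b∈V')))
              (trans (∨-repeat (fib v' z) (fib v z))
                     (cong (λ t → fib v z ∨ (fib v' z ∨ t)) (fib-congˡ z b'∈V)))

    -- V ≠ V', endpoints apart: with a third fibre U (the fibre of u), realise r x y
    -- between U and V' and between U and V, and compare inside U ∪ V ∪ V'.
    via-apart-across : ∀ {i j v v' x y x' y'} u → I i ≡ false → I j ≡ false →
                       fib v v' ≡ false → I (r x y) ≡ false → fib v u ≡ false → fib v' u ≡ false →
                       fib v x ≡ false → fib v y ≡ false → fib v' x' ≡ false → fib v' y' ≡ false →
                       r x y ≡ r x' y' → via v x y i j ≡ via v' x' y' i j
    via-apart-across {i} {j} {v} {v'} {x} {y} {x'} {y'} u i∉I j∉I vv' xy∉I vu v'u vx vy v'x' v'y' xy≡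
      with between-fibres {u} {v'} (λ s → true≢false (same-sym s) v'u) xy∉I
         | between-fibres {u} {v} (λ s → true≢false (same-sym s) vu) xy∉I
    ... | a , b , ua , v'b , ab | a' , b' , ua' , vb' , a'b' = begin
      via v x y i j    ≡⟨ count-outside (fibre-isUnion v) i j vx vy va vb (sym ab) ⟩
      via v a b i j    ≡⟨ via-swap i∉I j∉I (trans ab (sym a'b')) sameUnion ⟩
      via v' a' b' i j ≡⟨ count-outside (fibre-isUnion v') i j v'a' v'b' v'x' v'y' (trans a'b' xy≡) ⟩
      via v' x' y' i j ∎
      where
      va : fib v a ≡ false
      va = trans (fib-congʳ v (same-sym ua)) vu
      vb : fib v b ≡ false
      vb = trans (fib-congʳ v (same-sym v'b)) vv'
      v'a' : fib v' a' ≡ false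
      v'a' = trans (fib-congʳ v' (same-sym ua')) v'u
      v'b' : fib v' b' ≡ false
      v'b' = trans (fib-congʳ v' (same-sym vb')) (trans (fib-sym v' v) vv')
      sameUnion : ∀ z → (fib a ∪ fib v ∪ fib b) z ≡ (fib a' ∪ fib v' ∪ fib b') z
      sameUnion z =
        trans (cong₂ (λ s t → s ∨ (fib v z ∨ t)) (fib-congˡ z (same-sym ua)) (fib-congˡ z (same-sym v'b)))
              (trans (cong (fib u z ∨_) (∨-comm (fib v z) (fib v' z)))
                     (sym (cong₂ (λ s t → s ∨ (fib v' z ∨ t))
                                 (fib-congˡ z (same-sym ua')) (fib-congˡ z (same-sym vb')))))

    via-invariant : ∀ {i j v v' x y x' y'} → I i ≡ false → I j ≡ false →
                    fib v x ≡ false → fib v y ≡ false → fib v' x' ≡ false → fib v' y' ≡ false →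
                    r x y ≡ r x' y' → via v x y i j ≡ via v' x' y' i j
    via-invariant {v = v} {v'} {x} {y} i∉I j∉I vx vy v'x' v'y' xy≡ with fib v v' in vv' | I (r x y) in xy
    ... | true  | _    = via-sameFibre vv' vx vy v'x' v'y' xy≡
    ... | false | true = via-apart-inside i∉I j∉I vv' xy vx vy v'x' v'y' xy≡
    ... | false | false with apart-points v' xy
    ...   | inj₁ v'x = via-apart-across x i∉I j∉I vv' xy vx v'x vx vy v'x' v'y' xy≡
    ...   | inj₂ v'y = via-apart-across y i∉I j∉I vv' xy vy v'y vx vy v'x' v'y' xy≡

    -- h is realised by a pair outside some fibre; such a pair fixes the value
    -- of via-invariant at h.
    OutsidePair : Fin (suc d) → Set
    OutsidePair h = ∃ λ v → ∃ λ x → ∃ λ y → fib v x ≡ false × fib v y ≡ false × r x y ≡ h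

    outsidePair? : ∀ h → Dec (OutsidePair h)
    outsidePair? h = any? (λ v → any? (λ x → any? (λ y →
      (fib v x Bool.≟ false) ×-dec (fib v y Bool.≟ false) ×-dec (r x y ≟ h))))

    viaValue : ∀ h i j → Dec (OutsidePair h) → ℕ
    viaValue h i j (yes (v , x , y , _)) = via v x y i j
    viaValue h i j (no _)                = 0

    -- The uniformity coefficients a^h_ij: intersection numbers if a step stays
    -- in a fibre, and otherwise the invariant count of paths through a fibre.
    coefficient : Fin (suc d) → Fin (suc d) → Fin (suc d) → ℕ
    coefficient h i j = if I i ∨ I j then p h i j else viaValue h i j (outsidePair? h)

    coefficient-correct : ∀ {v x y i j} → fib v x ≡ I i → fib v y ≡ I j →
                          via v x y i j ≡ coefficient (r x y) i j
    coefficient-correct {v} {x} {y} {i} {j} vx vy with I i in i∈ | I j in j∈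
    ... | true  | _     = count-in-fibreˡ (fibre-isUnion v) y i j vx i∈
    ... | false | true  = count-in-fibreʳ (fibre-isUnion v) x i j vy j∈
    ... | false | false with outsidePair? (r x y)
    ...   | yes (_ , _ , _ , v₀x₀ , v₀y₀ , x₀y₀) = via-invariant i∈ j∈ vx vy v₀x₀ v₀y₀ (sym x₀y₀)
    ...   | no none = ⊥-elim (none (v , x , y , vx , vy , refl))

    uniform : Uniform r I
    uniform = trivialQuotient , coefficient , equation
      where
      trivialQuotient : ∀ u v → ¬ SameFibre r I u v → ∀ i → (InI r I u v i ⇔ I i ≡ false)
      trivialQuotient u v u≁v i = mk⇔ (λ occ → trans (InI-index occ) (¬-not u≁v)) (between-fibres u≁v)
      equation : ∀ u v w i j → InI r I u v i → InI r I v w j →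
                 (restrict (fib u) (fib v) (adj r i) ⊗ restrict (fib v) (fib w) (adj r j))
                 ≈ₘ (λ x y → Σ[ suc d ] (λ h → coefficient h i j * restrict (fib u) (fib w) (adj r h) x y))
      equation u v w i j uv vw x y = begin
        (restrict (fib u) (fib v) (adj r i) ⊗ restrict (fib v) (fib w) (adj r j)) x y
          ≡⟨ productEntry (fib u) (fib v) (fib w) i j x y ⟩
        (if fib u x ∧ fib w y then via v x y i j else 0)
          ≡⟨ if-congᵗ (fib u x ∧ fib w y) (λ both →
               coefficient-correct (InI-fibreˡ uv (proj₁ (∧-elim both)))
                                   (InI-fibreʳ vw (proj₂ (∧-elim both)))) ⟩
        (if fib u x ∧ fib w y then coefficient (r x y) i j else 0)
          ≡⟨ sym (combinationEntry (fib u) (fib w) (λ h → coefficient h i j) x y) ⟩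
        Σ[ suc d ] (λ h → coefficient h i j * restrict (fib u) (fib w) (adj r h) x y) ∎

  -- Uniform ⇒ dismantlable.

  module FromUniform (uniform : Uniform r I) where

    a : Fin (suc d) → Fin (suc d) → Fin (suc d) → ℕ
    a = proj₁ (proj₂ uniform)

    -- The uniformity equation at the entry (x,y), with U, W the fibres of x, y.
    via-coefficient : ∀ {i j} v x y → I i ≡ false → I j ≡ false →
                      fib x v ≡ false → fib v y ≡ false →
                      via v x y i j ≡ a (r x y) i j
    via-coefficient {i} {j} v x y i∉I j∉I xv vy = begin
      via v x y i j
        ≡⟨ sym (if-true diagonal) ⟩
      (if fib x x ∧ fib y y then via v x y i j else 0)
        ≡⟨ sym (productEntry (fib x) (fib v) (fib y) i j x y) ⟩
      (restrict (fib x) (fib v) (adj r i) ⊗ restrict (fib v) (fib y) (adj r j)) x y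
        ≡⟨ proj₂ (proj₂ uniform) x v y i j (across xv i∉I) (across vy j∉I) x y ⟩
      Σ[ suc d ] (λ h → a h i j * restrict (fib x) (fib y) (adj r h) x y)
        ≡⟨ combinationEntry (fib x) (fib y) (λ h → a h i j) x y ⟩
      (if fib x x ∧ fib y y then a (r x y) i j else 0)
        ≡⟨ if-true diagonal ⟩
      a (r x y) i j ∎
      where
      diagonal : fib x x ∧ fib y y ≡ true
      diagonal = cong₂ _∧_ (same-refl x) (same-refl y)
      across : ∀ {s t k} → fib s t ≡ false → I k ≡ false → InI r I s t k
      across {s} {t} {k} st k∉I =
        Equivalence.from (proj₁ uniform s t (λ same → true≢false same st) k) k∉I

    module _ {Y : Fin N → Bool} (uY : UnionOfFibres r I Y) where

      Y-cong : ∀ {z z'} → SameFibre r I z z' → Y z ≡ Y z'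
      Y-cong {z} {z'} zz' = bool-ext (λ Yz → uY z z' Yz zz') (λ Yz' → uY z' z Yz' (same-sym zz'))

      remote? : Fin N → Fin N → Fin N → Bool
      remote? x y z = not ((fib x ∪ fib y) z) ∧ Y z

      remote : Fin N → Fin N → ℕ
      remote x y = Σ[ N ] (λ z → ind (remote? x y z))

      -- Summing the uniformity equation over the remote z double counts the
      -- paths from x to y through Y, each once per point of its middle fibre.
      double-count : ∀ {i j} x y → I i ≡ false → I j ≡ false →
                     a (r x y) i j * remote x y ≡ count r Y x y i j * fibreCard
      double-count {i} {j} x y i∉I j∉I = begin
        a (r x y) i j * remote x y
          ≡⟨ sym (Σ-*ˡ N (a (r x y) i j) (λ z → ind (remote? x y z))) ⟩
        Σ[ N ] (λ z → a (r x y) i j * ind (remote? x y z))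
          ≡⟨ Σ-cong N (λ z → ind-scale (remote? x y z) (λ rz → sym (via-remote z rz))) ⟩
        Σ[ N ] (λ z → ind (remote? x y z) * via z x y i j)
          ≡⟨ Σ-cong N (λ z → sym (Σ-*ˡ N (ind (remote? x y z)) (λ z' → ind (onPath (fib z) x y i j z')))) ⟩
        Σ[ N ] (λ z → Σ[ N ] (λ z' → ind (remote? x y z) * ind (onPath (fib z) x y i j z')))
          ≡⟨ Σ-comm N N (λ z z' → ind (remote? x y z) * ind (onPath (fib z) x y i j z')) ⟩
        Σ[ N ] (λ z' → Σ[ N ] (λ z → ind (remote? x y z) * ind (onPath (fib z) x y i j z')))
          ≡⟨ Σ-cong N (λ z' → Σ-cong N (λ z →
               ind-exchange (remote? x y z) (fib z z') (Y z') _ (same-middle z z'))) ⟩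
        Σ[ N ] (λ z' → Σ[ N ] (λ z → ind (onPath Y x y i j z') * ind (fib z z')))
          ≡⟨ Σ-cong N (λ z' → trans (Σ-*ˡ N (ind (onPath Y x y i j z')) (λ z → ind (fib z z')))
                                     (cong (ind (onPath Y x y i j z') *_) (middle-fibre z'))) ⟩
        Σ[ N ] (λ z' → ind (onPath Y x y i j z') * fibreCard)
          ≡⟨ Σ-*ʳ N fibreCard (λ z' → ind (onPath Y x y i j z')) ⟩
        count r Y x y i j * fibreCard ∎
        where
        via-remote : ∀ z → remote? x y z ≡ true → via z x y i j ≡ a (r x y) i j
        via-remote z rz with not-∨ (proj₁ (∧-elim rz))
        ... | xz , yz = via-coefficient z x y i∉I j∉I xz (trans (fib-sym z y) yz)
        same-middle : ∀ z z' → fib z z' ≡ true → ⌊ r x z' ≟ i ⌋ ∧ ⌊ r z' y ≟ j ⌋ ≡ true →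
                      remote? x y z ≡ Y z'
        same-middle z z' zz' path with ∧-elim path
        ... | xz' , z'y =
          trans (cong₂ (λ s t → not (s ∨ t) ∧ Y z) xz yz) (Y-cong zz')
          where
          xz : fib x z ≡ false
          xz = trans (fib-congʳ x zz') (leaves i∉I (from-does (r x z' ≟ i) xz'))
          yz : fib y z ≡ false
          yz = trans (fib-congʳ y zz') (trans (fib-sym y z') (leaves j∉I (from-does (r z' y ≟ j) z'y)))
        middle-fibre : ∀ z' → Σ[ N ] (λ z → ind (fib z z')) ≡ fibreCard
        middle-fibre z' = trans (Σ-cong N (λ z → cong ind (fib-sym z z'))) (fibreSize z')

      remote-complement : ∀ x y → Y x ≡ true → Y y ≡ true →
                          remote x y + Σ[ N ] (λ z → ind ((fib x ∪ fib y) z)) ≡ Σ[ N ] (λ z → ind (Y z))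
      remote-complement x y Yx Yy = trans (sym (Σ-+ N _ _)) (Σ-cong N (λ z → sym
        (trans (ind-split ((fib x ∪ fib y) z) (Y z))
               (cong (ind (remote? x y z) +_) (cong ind (∧-implied (inY z)))))))
        where
        inY : ∀ z → (fib x ∪ fib y) z ≡ true → Y z ≡ true
        inY z xyz with ∨-elim {fib x z} xyz
        ... | inj₁ xz = uY x z Yx xz
        ... | inj₂ yz = uY y z Yy yz

      -- Hence, as |fib x ∪ fib y| depends only on r x y, so does remote x y.
      remote-invariant : ∀ {x y x' y'} → Y x ≡ true → Y y ≡ true → Y x' ≡ true → Y y' ≡ true →
                         r x y ≡ r x' y' → remote x y ≡ remote x' y'
      remote-invariant {x} {y} {x'} {y'} Yx Yy Yx' Yy' xy≡ =
        +-cancelʳ-≡ (Σ[ N ] (λ z → ind ((fib x ∪ fib y) z))) (remote x y) (remote x' y')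
          (trans (remote-complement x y Yx Yy)
          (trans (sym (remote-complement x' y' Yx' Yy'))
                 (cong (remote x' y' +_) (trans (pairSize x' y')
                   (trans (cong (λ h → if I h then fibreCard else fibreCard + fibreCard) (sym xy≡))
                          (sym (pairSize x y)))))))

      -- Paths with a step inside a fibre are counted globally; the others are
      -- determined by the double counting identity.
      count-invariant : CountInvariant Y
      count-invariant {x} {y} {x'} {y'} i j Yx Yy Yx' Yy' xy≡ with I i in i∈ | I j in j∈
      ... | true  | _    =
        trans (count-in-fibreˡ uY y i j Yx i∈)
              (trans (cong (λ h → p h i j) xy≡) (sym (count-in-fibreˡ uY y' i j Yx' i∈)))
      ... | false | true =
        trans (count-in-fibreʳ uY x i j Yy j∈)
              (trans (cong (λ h → p h i j) xy≡) (sym (count-in-fibreʳ uY x' i j Yy' j∈)))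
      ... | false | false = *-cancelʳ-≡ _ _ fibreCard {{>-nonZero (fibreCard-positive x)}} (begin
        count r Y x y i j * fibreCard   ≡⟨ sym (double-count x y i∈ j∈) ⟩
        a (r x y) i j * remote x y      ≡⟨ cong₂ _*_ (cong (λ h → a h i j) xy≡)
                                                     (remote-invariant Yx Yy Yx' Yy' xy≡) ⟩
        a (r x' y') i j * remote x' y'  ≡⟨ double-count x' y' i∈ j∈ ⟩
        count r Y x' y' i j * fibreCard ∎)

      subscheme : IsSchemeOn Y r
      subscheme = schemeOfInvariance Y count-invariant


theorem4p3 : (N d : ℕ) (r : Rel N d) (I : Fin (suc d) → Bool) →
    IsAssocScheme r → IsImprimitivitySystem r I →
    (Dismantlable r I ⇔ Uniform r I)
theorem4p3 N d r I scheme imprimitive =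
  mk⇔ FromDismantlable.uniform (λ uniform Y _ uY → FromUniform.subscheme uniform uY)
  where open Fibres r scheme I imprimitive
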